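{- Let $G$ be a cubic graph with $\mu_4(G) = 0$ (i.e. $E(G)$ is the union of four 1-factors). Then (1) $G$ has an even 4-cycle cover $\mathcal{C}$ of length $\frac{4}{3}|E(G)|$ with $ced_{\mathcal{C}}(G) \leq 2$; (2) $G$ has a 5-cycle double cover.
   Context: Graphs are finite, may have parallel edges, but no loops. A 1-factor is a spanning 1-regular subgraph, identified with its edge set. For a cubic graph $G$ with a 1-factor, $\mu_4(G) = |E(G)| - \max\{|M_1\cup\dots\cup M_4| : M_i \text{ 1-factors of } G\}$. A cycle is a subgraph all of whose vertices have even degree; in a cubic graph it is a disjoint union of circuits, and it is even if all its circuits have even length. A cycle cover is a set of cycles covering every edge at least once; an $l$-cycle cover has at most $l$ cycles; it is even if all its cycles are even; its length is $\sum_C |E(C)|$. A (5-)cycle double cover is a set of (at most 5) cycles such that every edge lies in precisely two of them. For a cycle cover $\mathcal{C}$ and $e \in E(G)$, $ced_{\mathcal{C}}(e)$ is the number of cycles of $\mathcal{C}$ containing $e$, and $ced_{\mathcal{C}}(G) = \max_{e\in E(G)} ced_{\mathcal{C}}(e)$. -}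

module Defs where

open import Data.Nat using (ℕ; zero; suc; _+_; _*_; _≤_; _%_)
open import Data.Fin using (Fin; zero; suc)
open import Data.Fin.Properties using (_≟_)
open import Data.Bool using (Bool; true; false; _∨_; _∧_; not; if_then_else_)
open import Data.Product using (_×_; _,_; proj₁; proj₂; Σ; ∃; ∃-syntax)
open import Data.Empty
open import Data.Sum using (_⊎_)
open import Relation.Nullary using (¬_; does)
open import Relation.Binary.PropositionalEquality using (_≡_; _≢_)

count : ∀ {k} → (Fin k → Bool) → ℕ
count {zero}  f = 0
count {suc k} f = (if f zero then 1 else 0) + count (λ i → f (suc i))

-- A finite multigraph without loops: vertices Fin n, edges Fin m,
-- each edge has two distinct endpoints (parallel edges allowed).
record Graph : Set where
  field
    n     : ℕ
    m     : ℕ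
    ends  : Fin m → Fin n × Fin n
    loopless : ∀ e → proj₁ (ends e) ≢ proj₂ (ends e)

module _ (G : Graph) where
  open Graph G

  Vertex : Set
  Vertex = Fin n

  Edge : Set
  Edge = Fin m

  EdgeSet : Set
  EdgeSet = Edge → Bool

  incident : Vertex → Edge → Bool
  incident v e = does (proj₁ (ends e) ≟ v) ∨ does (proj₂ (ends e) ≟ v)

  adjacent : Edge → Edge → Set
  adjacent e f = Σ Vertex λ v → incident v e ≡ true × incident v f ≡ true

  degIn : EdgeSet → Vertex → ℕ
  degIn S v = count (λ e → S e ∧ incident v e)

  size : EdgeSet → ℕ
  size S = count S

  Cubic : Set
  Cubic = ∀ v → degIn (λ _ → true) v ≡ 3

  IsOneFactor : EdgeSet → Set
  IsOneFactor M = ∀ v → degIn M v ≡ 1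

  _⊆_ : EdgeSet → EdgeSet → Set
  A ⊆ B = ∀ e → A e ≡ true → B e ≡ true

  IsCycle : EdgeSet → Set
  IsCycle C = ∀ v → degIn C v % 2 ≡ 0

  ConnectedEdges : EdgeSet → Set
  ConnectedEdges K = ∀ (A : EdgeSet) → A ⊆ K →
    (∃[ e ] A e ≡ true) → (∃[ f ] (K f ≡ true × A f ≡ false)) →
    ∃[ e ] ∃[ f ] (A e ≡ true × K f ≡ true × A f ≡ false × adjacent e f)

  IsCircuit : EdgeSet → Set
  IsCircuit K = (∃[ e ] K e ≡ true)
              × (∀ v → (degIn K v ≡ 0) ⊎ (degIn K v ≡ 2))
              × ConnectedEdges K

  IsEvenCycle : EdgeSet → Set
  IsEvenCycle C = IsCycle C × (∀ K → IsCircuit K → K ⊆ C → size K % 2 ≡ 0)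

  ced : ∀ {k} → (Fin k → EdgeSet) → Edge → ℕ
  ced 𝒞 e = count (λ i → 𝒞 i e)

  cycLength : ∀ {k} → (Fin k → EdgeSet) → ℕ
  cycLength {zero}  𝒞 = 0
  cycLength {suc k} 𝒞 = size (𝒞 zero) + cycLength (λ i → 𝒞 (suc i))

  Mu4Zero : Set
  Mu4Zero = ∃[ M ] ((∀ (i : Fin 4) → IsOneFactor (M i))
                    × (∀ e → ced M e ≡ 0 → Data.Empty.⊥))

-- At each vertex of a cubic graph the four 1-factors M i contribute four edge incidences to
-- three edges, each covered at least once; so exactly one edge at each vertex is covered twice,
-- and the doubly covered edges form a 1-factor N. Every M i Δ N lies in the union of two
-- perfect matchings, so all its circuits alternate between them and have even length. An edge
-- lies in as many of the M i Δ N as in the M i (once if simply covered, 4 − 2 times if doubly),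
-- so the four cycles have total length Σ |M i| = 2|V| = (4/3)|E|. Adding the 2-factor E − N
-- raises every edge to exactly two cycles, a 5-cycle double cover.
module Submission where

open import Defs
open import Algebra.Properties.CommutativeSemigroup using (interchange)
open import Data.Bool using (Bool; true; false; _∧_; _xor_; not; if_then_else_)
open import Data.Bool.Properties using (∧-zeroʳ; ∧-identityʳ; ∧-conicalʳ; xor-identityʳ; xor-comm)
open import Data.Empty using (⊥; ⊥-elim)
open import Data.Fin using (Fin; zero; suc)
open import Data.Fin.Properties using (_≟_)
open import Data.Nat using (ℕ; zero; suc; _+_; _*_; _∸_; _%_; _≤_; _<ᵇ_; z≤n; s≤s)
open import Data.Nat.DivMod using ([m+kn]%n≡m%n; m*n%n≡0)
open import Data.Nat.Properties hiding (_≟_)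
open import Data.Nat.Tactic.RingSolver using (solve-∀)
open import Data.Product using (_×_; ∃-syntax; _,_; proj₁; proj₂)
open import Data.Sum using (_⊎_; inj₁; inj₂; [_,_]′)
open import Function using (_∘_)
open import Relation.Nullary using (yes; no; does)
open import Relation.Binary.PropositionalEquality

open ≡-Reasoning

⟦_⟧ : Bool → ℕ
⟦ b ⟧ = if b then 1 else 0

⟦∧⟧ : ∀ a b → ⟦ a ∧ b ⟧ ≡ ⟦ a ⟧ * ⟦ b ⟧
⟦∧⟧ false b     = refl
⟦∧⟧ true  false = refl
⟦∧⟧ true  true  = refl

⟦⟧-mono : ∀ {a b} → (a ≡ true → b ≡ true) → ⟦ a ⟧ ≤ ⟦ b ⟧
⟦⟧-mono {false} a⇒b = z≤n
⟦⟧-mono {true}  a⇒b rewrite a⇒b refl = ≤-refl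

∑ : ∀ {k} → (Fin k → ℕ) → ℕ
∑ {zero}  f = 0
∑ {suc k} f = f zero + ∑ (f ∘ suc)

∑-cong : ∀ {k} {f g : Fin k → ℕ} → (∀ i → f i ≡ g i) → ∑ f ≡ ∑ g
∑-cong {zero}  f≗g = refl
∑-cong {suc k} f≗g = cong₂ _+_ (f≗g zero) (∑-cong (f≗g ∘ suc))

∑-mono : ∀ {k} {f g : Fin k → ℕ} → (∀ i → f i ≤ g i) → ∑ f ≤ ∑ g
∑-mono {zero}  f≤g = z≤n
∑-mono {suc k} f≤g = +-mono-≤ (f≤g zero) (∑-mono (f≤g ∘ suc))

∑-+ : ∀ {k} (f g : Fin k → ℕ) → ∑ (λ i → f i + g i) ≡ ∑ f + ∑ g
∑-+ {zero}  f g = refl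
∑-+ {suc k} f g = begin
  f zero + g zero + ∑ (λ i → f (suc i) + g (suc i))
    ≡⟨ cong (f zero + g zero +_) (∑-+ (f ∘ suc) (g ∘ suc)) ⟩
  f zero + g zero + (∑ (f ∘ suc) + ∑ (g ∘ suc))
    ≡⟨ interchange +-commutativeSemigroup (f zero) (g zero) _ _ ⟩
  f zero + ∑ (f ∘ suc) + (g zero + ∑ (g ∘ suc)) ∎

∑-*ʳ : ∀ {k} (f : Fin k → ℕ) c → ∑ (λ i → f i * c) ≡ ∑ f * c
∑-*ʳ {zero}  f c = refl
∑-*ʳ {suc k} f c =
  trans (cong (f zero * c +_) (∑-*ʳ (f ∘ suc) c)) (sym (*-distribʳ-+ c (f zero) _))

∑-const : ∀ k c → ∑ {k} (λ _ → c) ≡ k * c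
∑-const zero    c = refl
∑-const (suc k) c = cong (c +_) (∑-const k c)

∑-swap : ∀ {k l} (f : Fin k → Fin l → ℕ) → ∑ (λ i → ∑ (f i)) ≡ ∑ (λ j → ∑ (λ i → f i j))
∑-swap {zero}  {l} f = sym (trans (∑-const l 0) (*-zeroʳ l))
∑-swap {suc k}     f =
  trans (cong (∑ (f zero) +_) (∑-swap (f ∘ suc))) (sym (∑-+ (f zero) _))

term≤∑ : ∀ {k} (f : Fin k → ℕ) i → f i ≤ ∑ f
term≤∑ f zero    = m≤m+n _ _
term≤∑ f (suc i) = ≤-trans (term≤∑ (f ∘ suc) i) (m≤n+m _ _)

count-∑ : ∀ {k} (f : Fin k → Bool) → count f ≡ ∑ (⟦_⟧ ∘ f)
count-∑ {zero}  f = refl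
count-∑ {suc k} f = cong (⟦ f zero ⟧ +_) (count-∑ (f ∘ suc))

count-cong : ∀ {k} {f g : Fin k → Bool} → (∀ i → f i ≡ g i) → count f ≡ count g
count-cong {zero}  f≗g = refl
count-cong {suc k} f≗g = cong₂ _+_ (cong ⟦_⟧ (f≗g zero)) (count-cong (f≗g ∘ suc))

count-+ : ∀ {k} {f g h : Fin k → Bool} → (∀ i → ⟦ f i ⟧ ≡ ⟦ g i ⟧ + ⟦ h i ⟧) →
          count f ≡ count g + count h
count-+ {f = f} {g} {h} split = begin
  count f                                ≡⟨ count-∑ f ⟩
  ∑ (⟦_⟧ ∘ f)                            ≡⟨ ∑-cong split ⟩
  ∑ (λ i → ⟦ g i ⟧ + ⟦ h i ⟧)            ≡⟨ ∑-+ (⟦_⟧ ∘ g) (⟦_⟧ ∘ h) ⟩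
  ∑ (⟦_⟧ ∘ g) + ∑ (⟦_⟧ ∘ h)              ≡⟨ sym (cong₂ _+_ (count-∑ g) (count-∑ h)) ⟩
  count g + count h                      ∎

count-mono : ∀ {k} {f g : Fin k → Bool} → (∀ i → f i ≡ true → g i ≡ true) → count f ≤ count g
count-mono {f = f} {g} f⇒g =
  subst₂ _≤_ (sym (count-∑ f)) (sym (count-∑ g)) (∑-mono (⟦⟧-mono ∘ f⇒g))

count-false : ∀ k → count {k} (λ _ → false) ≡ 0
count-false zero    = refl
count-false (suc k) = count-false k

count-true : ∀ k → count {k} (λ _ → true) ≡ k
count-true zero    = refl
count-true (suc k) = cong suc (count-true k)

count-not : ∀ {k} (f : Fin k → Bool) → count (not ∘ f) + count f ≡ k
count-not {k} f = trans (sym (count-+ λ i → complement (f i))) (count-true k)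
  where
  complement : ∀ b → ⟦ true ⟧ ≡ ⟦ not b ⟧ + ⟦ b ⟧
  complement false = refl
  complement true  = refl

count-∧ʳ : ∀ {k} (f : Fin k → Bool) b → count (λ i → f i ∧ b) ≡ count f * ⟦ b ⟧
count-∧ʳ {k} f false =
  trans (count-cong (∧-zeroʳ ∘ f)) (trans (count-false k) (sym (*-zeroʳ (count f))))
count-∧ʳ     f true  = trans (count-cong (∧-identityʳ ∘ f)) (sym (*-identityʳ (count f)))

count-≟ : ∀ {k} (i : Fin k) → count (λ j → does (i ≟ j)) ≡ 1
count-≟ {suc k} zero    = cong suc (count-false k)
count-≟         (suc i) = count-≟ i

count-swap : ∀ {k l} (R : Fin k → Fin l → Bool) →
             ∑ (λ i → count (R i)) ≡ ∑ (λ j → count (λ i → R i j))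
count-swap R = begin
  ∑ (λ i → count (R i))                  ≡⟨ ∑-cong (count-∑ ∘ R) ⟩
  ∑ (λ i → ∑ (λ j → ⟦ R i j ⟧))          ≡⟨ ∑-swap (λ i j → ⟦ R i j ⟧) ⟩
  ∑ (λ j → ∑ (λ i → ⟦ R i j ⟧))          ≡⟨ ∑-cong (λ j → sym (count-∑ (λ i → R i j))) ⟩
  ∑ (λ j → count (λ i → R i j))          ∎

≤1-even-sum : ∀ {a b} → a ≤ 1 → b ≤ 1 → (a + b) % 2 ≡ 0 → a + b ≡ a * 2
≤1-even-sum {0}     {0}     _       _       _  = refl
≤1-even-sum {0}     {1}     _       _       ()
≤1-even-sum {1}     {0}     _       _       ()
≤1-even-sum {1}     {1}     _       _       _  = refl
≤1-even-sum {suc (suc _)} (s≤s ()) _        _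
≤1-even-sum {_} {suc (suc _)} _     (s≤s ()) _

one-or-two : ∀ {c} → 1 ≤ c → c ∸ 1 ≤ 1 → c ≡ 1 ⊎ c ≡ 2
one-or-two {1}                 _ _        = inj₁ refl
one-or-two {2}                 _ _        = inj₂ refl
one-or-two {suc (suc (suc _))} _ (s≤s ())

⟦1<ᵇ⟧ : ∀ {c} → c ≡ 1 ⊎ c ≡ 2 → ⟦ 1 <ᵇ c ⟧ ≡ c ∸ 1
⟦1<ᵇ⟧ (inj₁ refl) = refl
⟦1<ᵇ⟧ (inj₂ refl) = refl

⟦1≮ᵇ⟧+ : ∀ {c} → c ≡ 1 ⊎ c ≡ 2 → ⟦ not (1 <ᵇ c) ⟧ + c ≡ 2
⟦1≮ᵇ⟧+ (inj₁ refl) = refl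
⟦1≮ᵇ⟧+ (inj₂ refl) = refl

module _ (G : Graph) where
  open Graph G

  incident-count : ∀ e → count (λ v → incident G v e) ≡ 2
  incident-count e = trans (count-+ split) (cong₂ _+_ (count-≟ a) (count-≟ b))
    where
    a = proj₁ (ends e)
    b = proj₂ (ends e)
    split : ∀ v → ⟦ incident G v e ⟧ ≡ ⟦ does (a ≟ v) ⟧ + ⟦ does (b ≟ v) ⟧
    split v with a ≟ v | b ≟ v
    ... | yes a≡v | yes b≡v = ⊥-elim (loopless e (trans a≡v (sym b≡v)))
    ... | yes _   | no _    = refl
    ... | no _    | yes _   = refl
    ... | no _    | no _    = refl

  incident-endpoint : ∀ e → incident G (proj₁ (ends e)) e ≡ true
  incident-endpoint e with proj₁ (ends e) ≟ proj₁ (ends e)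
  ... | yes _ = refl
  ... | no a≢a = ⊥-elim (a≢a refl)

  handshake : ∀ S → ∑ (degIn G S) ≡ size G S * 2
  handshake S = begin
    ∑ (λ v → count (λ e → S e ∧ incident G v e))  ≡⟨ count-swap (λ v e → S e ∧ incident G v e) ⟩
    ∑ (λ e → count (λ v → S e ∧ incident G v e))  ≡⟨ ∑-cong per-edge ⟩
    ∑ (λ e → ⟦ S e ⟧ * 2)                         ≡⟨ ∑-*ʳ (⟦_⟧ ∘ S) 2 ⟩
    ∑ (⟦_⟧ ∘ S) * 2                               ≡⟨ cong (_* 2) (count-∑ S) ⟨
    size G S * 2                                  ∎
    where
    per-edge : ∀ e → count (λ v → S e ∧ incident G v e) ≡ ⟦ S e ⟧ * 2
    per-edge e with S e
    ... | true  = incident-count e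
    ... | false = count-false n

  degIn-mono : ∀ {A B} → _⊆_ G A B → ∀ v → degIn G A v ≤ degIn G B v
  degIn-mono {A} A⊆B v = count-mono λ e → restrict (A e) (A⊆B e)
    where
    restrict : ∀ {b} a {t} → (a ≡ true → b ≡ true) → a ∧ t ≡ true → b ∧ t ≡ true
    restrict true a⇒b at rewrite a⇒b refl = at

  complement-degree : ∀ S v → degIn G (not ∘ S) v + degIn G S v ≡ degIn G (λ _ → true) v
  complement-degree S v = sym (count-+ λ e → split (S e) (incident G v e))
    where
    split : ∀ s t → ⟦ t ⟧ ≡ ⟦ not s ∧ t ⟧ + ⟦ s ∧ t ⟧
    split false t     = sym (+-identityʳ _)
    split true  false = refl
    split true  true  = refl

  symdiff-degree : ∀ M N v →
    degIn G (λ e → M e xor N e) v + degIn G (λ e → M e ∧ N e) v * 2 ≡ degIn G M v + degIn G N v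
  symdiff-degree M N v = begin
    count (λ e → X e ∧ t e) + count (λ e → Y e ∧ t e) * 2
      ≡⟨ cong₂ (λ x y → x + y * 2) (count-∑ (λ e → X e ∧ t e)) (count-∑ (λ e → Y e ∧ t e)) ⟩
    ∑ (λ e → ⟦ X e ∧ t e ⟧) + ∑ (λ e → ⟦ Y e ∧ t e ⟧) * 2
      ≡⟨ cong (∑ (λ e → ⟦ X e ∧ t e ⟧) +_) (∑-*ʳ (λ e → ⟦ Y e ∧ t e ⟧) 2) ⟨
    ∑ (λ e → ⟦ X e ∧ t e ⟧) + ∑ (λ e → ⟦ Y e ∧ t e ⟧ * 2)
      ≡⟨ ∑-+ (λ e → ⟦ X e ∧ t e ⟧) (λ e → ⟦ Y e ∧ t e ⟧ * 2) ⟨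
    ∑ (λ e → ⟦ X e ∧ t e ⟧ + ⟦ Y e ∧ t e ⟧ * 2)
      ≡⟨ ∑-cong (λ e → pointwise (M e) (N e) (t e)) ⟩
    ∑ (λ e → ⟦ M e ∧ t e ⟧ + ⟦ N e ∧ t e ⟧)
      ≡⟨ ∑-+ (λ e → ⟦ M e ∧ t e ⟧) (λ e → ⟦ N e ∧ t e ⟧) ⟩
    ∑ (λ e → ⟦ M e ∧ t e ⟧) + ∑ (λ e → ⟦ N e ∧ t e ⟧)
      ≡⟨ cong₂ _+_ (count-∑ (λ e → M e ∧ t e)) (count-∑ (λ e → N e ∧ t e)) ⟨
    count (λ e → M e ∧ t e) + count (λ e → N e ∧ t e) ∎
    where
    X Y t : Fin m → Bool
    X e = M e xor N e
    Y e = M e ∧ N e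
    t e = incident G v e
    pointwise : ∀ a b t → ⟦ (a xor b) ∧ t ⟧ + ⟦ (a ∧ b) ∧ t ⟧ * 2 ≡ ⟦ a ∧ t ⟧ + ⟦ b ∧ t ⟧
    pointwise false b     t     = +-identityʳ ⟦ b ∧ t ⟧
    pointwise true  false false = refl
    pointwise true  false true  = refl
    pointwise true  true  false = refl
    pointwise true  true  true  = refl

  symdiff-isCycle : ∀ {M N} → IsOneFactor G M → IsOneFactor G N → IsCycle G (λ e → M e xor N e)
  symdiff-isCycle {M} {N} M-one N-one v = begin
    degIn G X v % 2                                      ≡⟨ [m+kn]%n≡m%n (degIn G X v) (degIn G Y v) 2 ⟨
    (degIn G X v + degIn G Y v * 2) % 2                  ≡⟨ cong (_% 2) (symdiff-degree M N v) ⟩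
    (degIn G M v + degIn G N v) % 2                      ≡⟨ cong₂ (λ a b → (a + b) % 2) (M-one v) (N-one v) ⟩
    0                                                    ∎
    where
    X Y : EdgeSet G
    X e = M e xor N e
    Y e = M e ∧ N e

  -- At each vertex a cycle K ⊆ M Δ N meets as many M-edges as N-edges (both at most one, with
  -- even sum), so by the handshake lemma K has twice as many edges as K ∩ M.
  symdiff-cycle-even : ∀ {M N K} → (∀ v → degIn G M v ≤ 1) → (∀ v → degIn G N v ≤ 1) →
    IsCycle G K → _⊆_ G K (λ e → M e xor N e) → size G K % 2 ≡ 0
  symdiff-cycle-even {M} {N} {K} M≤1 N≤1 K-cycle K⊆M⊕N =
    subst (λ s → s % 2 ≡ 0) (sym size-K) (m*n%n≡0 (size G A) 2)
    where
    A B : EdgeSet G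
    A e = K e ∧ M e
    B e = K e ∧ N e

    split : ∀ k a b t → (k ≡ true → (a xor b) ≡ true) → ⟦ k ∧ t ⟧ ≡ ⟦ (k ∧ a) ∧ t ⟧ + ⟦ (k ∧ b) ∧ t ⟧
    split false a     b     t _   = refl
    split true  false true  t _   = refl
    split true  true  false t _   = sym (+-identityʳ ⟦ t ⟧)
    split true  false false t k⇒x with () ← k⇒x refl
    split true  true  true  t k⇒x with () ← k⇒x refl

    degree-split : ∀ v → degIn G K v ≡ degIn G A v + degIn G B v
    degree-split v = count-+ λ e → split (K e) (M e) (N e) (incident G v e) (K⊆M⊕N e)

    degree-K : ∀ v → degIn G K v ≡ degIn G A v * 2
    degree-K v = trans (degree-split v) (≤1-even-sum A≤1 B≤1 A+B-even)
      where
      A+B-even : (degIn G A v + degIn G B v) % 2 ≡ 0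
      A+B-even = subst (λ d → d % 2 ≡ 0) (degree-split v) (K-cycle v)
      A≤1 : degIn G A v ≤ 1
      A≤1 = ≤-trans (degIn-mono (λ e → ∧-conicalʳ (K e) (M e)) v) (M≤1 v)
      B≤1 : degIn G B v ≤ 1
      B≤1 = ≤-trans (degIn-mono (λ e → ∧-conicalʳ (K e) (N e)) v) (N≤1 v)

    size-K : size G K ≡ size G A * 2
    size-K = *-cancelʳ-≡ _ _ 2 (begin
      size G K * 2                ≡⟨ handshake K ⟨
      ∑ (degIn G K)               ≡⟨ ∑-cong degree-K ⟩
      ∑ (λ v → degIn G A v * 2)   ≡⟨ ∑-*ʳ (degIn G A) 2 ⟩
      ∑ (degIn G A) * 2           ≡⟨ cong (_* 2) (handshake A) ⟩
      size G A * 2 * 2            ∎)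

  circuit-isCycle : ∀ {K} → IsCircuit G K → IsCycle G K
  circuit-isCycle (_ , zero-or-two , _) v = [ cong (_% 2) , cong (_% 2) ]′ (zero-or-two v)

  symdiff-isEvenCycle : ∀ {M N} → IsOneFactor G M → IsOneFactor G N →
                        IsEvenCycle G (λ e → M e xor N e)
  symdiff-isEvenCycle M-one N-one =
      symdiff-isCycle M-one N-one
    , λ K K-circuit K⊆M⊕N →
        symdiff-cycle-even (≤-reflexive ∘ M-one) (≤-reflexive ∘ N-one)
                           (circuit-isCycle K-circuit) K⊆M⊕N

  complement-isCycle : Cubic G → ∀ {N} → IsOneFactor G N → IsCycle G (not ∘ N)
  complement-isCycle cubic {N} N-one v =
    cong (_% 2) (+-cancelʳ-≡ 1 _ 2 (trans (cong (degIn G (not ∘ N) v +_) (sym (N-one v)))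
                                          (trans (complement-degree N v) (cubic v))))

  size-oneFactor : ∀ {M} → IsOneFactor G M → size G M * 2 ≡ n
  size-oneFactor {M} M-one = begin
    size G M * 2        ≡⟨ handshake M ⟨
    ∑ (degIn G M)       ≡⟨ ∑-cong M-one ⟩
    ∑ {n} (λ _ → 1)     ≡⟨ ∑-const n 1 ⟩
    n * 1               ≡⟨ *-identityʳ n ⟩
    n                   ∎

  size-cubic : Cubic G → m * 2 ≡ n * 3
  size-cubic cubic = begin
    m * 2                        ≡⟨ cong (_* 2) (count-true m) ⟨
    size G (λ _ → true) * 2      ≡⟨ handshake (λ _ → true) ⟨
    ∑ (degIn G (λ _ → true))     ≡⟨ ∑-cong cubic ⟩
    ∑ {n} (λ _ → 3)              ≡⟨ ∑-const n 3 ⟩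
    n * 3                        ∎

  cycLength-∑size : ∀ {k} (𝒞 : Fin k → EdgeSet G) → cycLength G 𝒞 ≡ ∑ (λ i → size G (𝒞 i))
  cycLength-∑size {zero}  𝒞 = refl
  cycLength-∑size {suc k} 𝒞 = cong (size G (𝒞 zero) +_) (cycLength-∑size (𝒞 ∘ suc))

  cycLength-∑ced : ∀ {k} (𝒞 : Fin k → EdgeSet G) → cycLength G 𝒞 ≡ ∑ (ced G 𝒞)
  cycLength-∑ced 𝒞 = trans (cycLength-∑size 𝒞) (count-swap 𝒞)

  cycLength-oneFactors : ∀ {k} (𝒞 : Fin k → EdgeSet G) → (∀ i → IsOneFactor G (𝒞 i)) →
                         cycLength G 𝒞 * 2 ≡ k * n
  cycLength-oneFactors {k} 𝒞 𝒞-one = begin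
    cycLength G 𝒞 * 2                ≡⟨ cong (_* 2) (cycLength-∑size 𝒞) ⟩
    ∑ (λ i → size G (𝒞 i)) * 2       ≡⟨ ∑-*ʳ (λ i → size G (𝒞 i)) 2 ⟨
    ∑ (λ i → size G (𝒞 i) * 2)       ≡⟨ ∑-cong (size-oneFactor ∘ 𝒞-one) ⟩
    ∑ {k} (λ _ → n)                  ≡⟨ ∑-const k n ⟩
    k * n                            ∎

  ∑ced-at-vertex : ∀ {k} (𝒞 : Fin k → EdgeSet G) v →
                   ∑ (λ e → ced G 𝒞 e * ⟦ incident G v e ⟧) ≡ ∑ (λ i → degIn G (𝒞 i) v)
  ∑ced-at-vertex 𝒞 v = begin
    ∑ (λ e → ced G 𝒞 e * ⟦ incident G v e ⟧)
      ≡⟨ ∑-cong (λ e → count-∧ʳ (λ i → 𝒞 i e) (incident G v e)) ⟨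
    ∑ (λ e → count (λ i → 𝒞 i e ∧ incident G v e))
      ≡⟨ count-swap (λ i e → 𝒞 i e ∧ incident G v e) ⟨
    ∑ (λ i → degIn G (𝒞 i) v)
      ∎

module FourFactorCover (G : Graph) (cubic : Cubic G) (M : Fin 4 → EdgeSet G)
                       (M-one : ∀ i → IsOneFactor G (M i)) (M-covers : ∀ e → ced G M e ≡ 0 → ⊥)
                       where
  open Graph G

  ced-positive : ∀ e → 1 ≤ ced G M e
  ced-positive e with ced G M e | M-covers e
  ... | zero  | uncovered = ⊥-elim (uncovered refl)
  ... | suc _ | _         = s≤s z≤n

  excess-at-vertex : ∀ v → ∑ (λ e → (ced G M e ∸ 1) * ⟦ incident G v e ⟧) ≡ 1
  excess-at-vertex v = +-cancelˡ-≡ 3 _ _ (begin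
    3 + ∑ excess                               ≡⟨ cong (_+ ∑ excess) degree-v ⟨
    ∑ (⟦_⟧ ∘ incident G v) + ∑ excess          ≡⟨ ∑-+ (⟦_⟧ ∘ incident G v) excess ⟨
    ∑ (λ e → ⟦ incident G v e ⟧ + excess e)    ≡⟨ ∑-cong (λ e → cong (_* ⟦ incident G v e ⟧)
                                                                    (m+[n∸m]≡n (ced-positive e))) ⟩
    ∑ (λ e → ced G M e * ⟦ incident G v e ⟧)   ≡⟨ ∑ced-at-vertex G M v ⟩
    ∑ (λ i → degIn G (M i) v)                  ≡⟨ ∑-cong (λ i → M-one i v) ⟩
    4                                          ∎)
    where
    excess : Fin m → ℕ
    excess e = (ced G M e ∸ 1) * ⟦ incident G v e ⟧
    degree-v : ∑ (⟦_⟧ ∘ incident G v) ≡ 3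
    degree-v = trans (sym (count-∑ (incident G v))) (cubic v)

  ced-one-or-two : ∀ e → ced G M e ≡ 1 ⊎ ced G M e ≡ 2
  ced-one-or-two e = one-or-two (ced-positive e) (≤-trans (≤-reflexive excess-e)
                       (≤-trans (term≤∑ _ e) (≤-reflexive (excess-at-vertex v))))
    where
    v = proj₁ (ends e)
    excess-e : ced G M e ∸ 1 ≡ (ced G M e ∸ 1) * ⟦ incident G v e ⟧
    excess-e = trans (sym (*-identityʳ _))
                     (cong (λ b → (ced G M e ∸ 1) * ⟦ b ⟧) (sym (incident-endpoint G e)))

  ced≤2 : ∀ e → ced G M e ≤ 2
  ced≤2 e with ced-one-or-two e
  ... | inj₁ once  = ≤-trans (≤-reflexive once) (n≤1+n 1)
  ... | inj₂ twice = ≤-reflexive twice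

  doubly : EdgeSet G
  doubly e = 1 <ᵇ ced G M e

  doubly-isOneFactor : IsOneFactor G doubly
  doubly-isOneFactor v = begin
    degIn G doubly v                                    ≡⟨ count-∑ (λ e → doubly e ∧ incident G v e) ⟩
    ∑ (λ e → ⟦ doubly e ∧ incident G v e ⟧)             ≡⟨ ∑-cong excess-indicator ⟩
    ∑ (λ e → (ced G M e ∸ 1) * ⟦ incident G v e ⟧)      ≡⟨ excess-at-vertex v ⟩
    1                                                   ∎
    where
    excess-indicator : ∀ e → ⟦ doubly e ∧ incident G v e ⟧ ≡ (ced G M e ∸ 1) * ⟦ incident G v e ⟧
    excess-indicator e = trans (⟦∧⟧ (doubly e) (incident G v e))
                               (cong (_* ⟦ incident G v e ⟧) (⟦1<ᵇ⟧ (ced-one-or-two e)))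

  𝒞 : Fin 4 → EdgeSet G
  𝒞 i e = M i e xor doubly e

  𝒞-even : ∀ i → IsEvenCycle G (𝒞 i)
  𝒞-even i = symdiff-isEvenCycle G (M-one i) doubly-isOneFactor

  ced-𝒞 : ∀ e → ced G 𝒞 e ≡ ced G M e
  ced-𝒞 e with ced-one-or-two e
  ... | inj₁ once = begin
    ced G 𝒞 e                        ≡⟨ cong (λ c → count (λ i → M i e xor (1 <ᵇ c))) once ⟩
    count (λ i → M i e xor false)    ≡⟨ count-cong (λ i → xor-identityʳ (M i e)) ⟩
    ced G M e                        ∎
  ... | inj₂ twice = begin
    ced G 𝒞 e                        ≡⟨ cong (λ c → count (λ i → M i e xor (1 <ᵇ c))) twice ⟩
    count (λ i → M i e xor true)     ≡⟨ count-cong (λ i → xor-comm (M i e) true) ⟩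
    count (λ i → not (M i e))        ≡⟨ +-cancelʳ-≡ 2 _ 2 complement ⟩
    2                                ≡⟨ twice ⟨
    ced G M e                        ∎
    where
    complement : count (λ i → not (M i e)) + 2 ≡ 4
    complement = subst (λ c → count (λ i → not (M i e)) + c ≡ 4) twice (count-not (λ i → M i e))

  length-𝒞 : 3 * cycLength G 𝒞 ≡ 4 * m
  length-𝒞 = *-cancelʳ-≡ _ _ 2 (begin
    3 * cycLength G 𝒞 * 2      ≡⟨ *-assoc 3 (cycLength G 𝒞) 2 ⟩
    3 * (cycLength G 𝒞 * 2)    ≡⟨ cong (λ l → 3 * (l * 2)) same-length ⟩
    3 * (cycLength G M * 2)    ≡⟨ cong (3 *_) (cycLength-oneFactors G M M-one) ⟩
    3 * (4 * n)                ≡⟨ reorder n ⟩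
    4 * (n * 3)                ≡⟨ cong (4 *_) (size-cubic G cubic) ⟨
    4 * (m * 2)                ≡⟨ *-assoc 4 m 2 ⟨
    4 * m * 2                  ∎)
    where
    same-length : cycLength G 𝒞 ≡ cycLength G M
    same-length = trans (cycLength-∑ced G 𝒞) (trans (∑-cong ced-𝒞) (sym (cycLength-∑ced G M)))
    reorder : ∀ n → 3 * (4 * n) ≡ 4 * (n * 3)
    reorder = solve-∀

  𝒟 : Fin 5 → EdgeSet G
  𝒟 zero    = not ∘ doubly
  𝒟 (suc i) = 𝒞 i

  𝒟-cycle : ∀ i → IsCycle G (𝒟 i)
  𝒟-cycle zero    = complement-isCycle G cubic doubly-isOneFactor
  𝒟-cycle (suc i) = proj₁ (𝒞-even i)

  ced-𝒟 : ∀ e → ced G 𝒟 e ≡ 2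
  ced-𝒟 e = trans (cong (⟦ not (doubly e) ⟧ +_) (ced-𝒞 e)) (⟦1≮ᵇ⟧+ (ced-one-or-two e))

mainTheorem17 : (G : Graph) → Cubic G → Mu4Zero G →
    (∃[ 𝒞 ] ((∀ (i : Fin 4) → IsEvenCycle G (𝒞 i))
             × (∀ e → 1 ≤ ced G 𝒞 e)
             × (3 * cycLength G 𝒞 ≡ 4 * Graph.m G)
             × (∀ e → ced G 𝒞 e ≤ 2)))
    × (∃[ 𝒟 ] ((∀ (i : Fin 5) → IsCycle G (𝒟 i))
             × (∀ e → ced G 𝒟 e ≡ 2)))
mainTheorem17 G cubic (M , M-one , M-covers) =
    (𝒞 , 𝒞-even , (λ e → subst (1 ≤_) (sym (ced-𝒞 e)) (ced-positive e)) , length-𝒞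
    , (λ e → subst (_≤ 2) (sym (ced-𝒞 e)) (ced≤2 e)))
  , (𝒟 , 𝒟-cycle , ced-𝒟)
  where open FourFactorCover G cubic M M-one M-covers
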